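{- Let $p$ be a prime such that $2$ is a primitive root modulo $p$. Then $S_p(2^p)=p$, where for $x\in\mathbb{N}$, $$S_p(x)=\sum_{0\le n<x,\ n\equiv 0 \ (\mathrm{mod}\ p)}(-1)^{\sigma(n)},$$ and $\sigma(n)$ denotes the number of $1$'s in the binary expansion of $n$.
   Context: For $m,x\in\mathbb{N}$, $S_m(x)=\sum_{0\le n<x,\ m\mid n}(-1)^{\sigma(n)}$, where $\sigma(n)$ is the binary digit sum (number of ones in the binary expansion) of $n$. -}

module Defs where

open import Data.Nat using (ℕ; zero; suc; _+_; _*_; _∸_; _^_; _<_; _≤_; NonZero)
open import Data.Nat.DivMod using (_%_; _/_)
open import Data.Nat.Divisibility using (_∣_; _∣?_)
open import Data.Integer using (ℤ; +_; -_)
open import Data.Nat.Primality using (Prime)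
open import Data.Product using (_×_)
open import Relation.Nullary using (¬_)
open import Relation.Nullary.Decidable using (does)
open import Data.Bool using (if_then_else_)

-- binary digit sum with fuel; fuel ≥ n suffices since n/2 < n for n > 0
σ-fuel : ℕ → ℕ → ℕ
σ-fuel zero    n = 0
σ-fuel (suc f) n = n % 2 + σ-fuel f (n / 2)

σ : ℕ → ℕ
σ n = σ-fuel n n

negOnePow : ℕ → ℤ
negOnePow zero    = + 1
negOnePow (suc k) = - negOnePow k

S : ℕ → ℕ → ℤ
S m zero    = + 0
S m (suc x) = S m x Data.Integer.+ (if does (m ∣? x) then negOnePow (σ x) else + 0)

PrimitiveRoot2 : (p : ℕ) → .{{NonZero p}} → Set
PrimitiveRoot2 p = (2 ^ (p ∸ 1) % p ≡ 1 % p) × (∀ k → 1 ≤ k → k < p ∸ 1 → ¬ (2 ^ k % p ≡ 1 % p))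
  where open import Relation.Binary.PropositionalEquality using (_≡_)

-- Write S′ r x for the sum of (−1)^σ(n) over n < x with p ∣ r + n.  Splitting [0, 2^(m+1)) into
-- halves and using σ (2^m + n) = 1 + σ n gives S′ r (2^(m+1)) = S′ r (2^m) − S′ (r + 2^m) (2^m),
-- so S_p(2^p) = Δ L 0 for the multiset L = {2^0, 2^1, …, 2^(p−1)}, where
-- Δ L r = Σ_{T ⊆ L} (−1)^|T| [p ∣ r + ΣT] is the coefficient of x^(−r) in ∏_{e ∈ L} (1 − x^e)
-- computed in ℤ[x]/(x^p − 1).  Δ only sees L modulo p and up to order, and as 2 is a primitive
-- root, L ≡ {1} ⊎ {1, …, p−1}.  Grade Δ by k = |T|: adding 1 to every element of the full residue
-- system {0, …, p−1} permutes it, so its k-th graded part is k-periodic as well as p-periodic in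
-- r, hence constant for 0 < k < p.  Peeling off the element 0, this telescopes to
-- Δ {1, …, p−1} r − Δ {1, …, p−1} 0 = p ([p ∣ r] − [p ∣ 0]), and therefore
-- Δ ({1} ⊎ {1, …, p−1}) 0 = Δ {1, …, p−1} 0 − Δ {1, …, p−1} 1 = p.

module Submission where

open import Defs
open import Data.Nat using (ℕ; _^_)
open import Data.Nat.Primality using (Prime; prime⇒nonZero)
open import Data.Integer using (+_)
open import Relation.Binary.PropositionalEquality using (_≡_)

open import Data.Bool using (if_then_else_)
open import Data.Empty using (⊥-elim)
open import Data.Integer using (ℤ; -_; -1ℤ) renaming (_+_ to _+ᶻ_; _-_ to _-ᶻ_; _*_ to _*ᶻ_)
import Data.Integer.Properties as ℤ
open import Data.Integer.Tactic.RingSolver using (solve-∀)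
open import Data.List using (List; []; _∷_; _++_; map; length; _∷ʳ_; applyUpTo; applyDownFrom; upTo)
open import Data.List.Membership.Propositional using (_∈_)
open import Data.List.Membership.Propositional.Properties
  using (∈-∃++; ∈-applyUpTo⁺; ∈-applyDownFrom⁻)
open import Data.List.Properties
  using (length-map; length-applyUpTo; length-applyDownFrom; map-applyUpTo; map-applyDownFrom;
         applyUpTo-∷ʳ; map-++; length-++-sucʳ)
open import Data.List.Relation.Binary.Permutation.Propositional
  using (_↭_; refl; prep; swap; trans; ↭-sym)
open import Data.List.Relation.Binary.Permutation.Propositional.Properties
  using (∈-resp-↭; shift; ∷↭∷ʳ; ↭-length)
open import Data.List.Relation.Binary.Subset.Propositional using (_⊆_)
import Data.List.Relation.Unary.All as All
open import Data.List.Relation.Unary.AllPairs using ([]; _∷_)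
open import Data.List.Relation.Unary.Any using (here; there)
open import Data.List.Relation.Unary.Unique.Propositional using (Unique)
open import Data.List.Relation.Unary.Unique.Propositional.Properties using (applyDownFrom⁺₁)
open import Data.Nat using (zero; suc; _+_; _*_; _∸_; _≤_; _<_; z≤n; s≤s; NonZero)
open import Data.Nat.Coprimality using (Coprime; coprime-Bézout; prime⇒coprime)
open import Data.Nat.Divisibility
  using (_∣_; _∣?_; divides; _∣0; ∣⇒≤; ∣-trans; m∣m*n; m%n≡0⇒n∣m; n∣m⇒m%n≡0)
open import Data.Nat.DivMod
open import Data.Nat.GCD using (module Bézout)
open import Data.Nat.Primality using (prime⇒nonTrivial; euclidsLemma; ¬prime[0])
open import Data.Nat.Base using (nonTrivial⇒n>1)
open import Data.Nat.Properties
import Data.Nat.Tactic.RingSolver as ℕ-Solver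
open import Data.Product using (_,_; proj₁; proj₂)
open import Data.Sum using ([_,_]′)
open import Function using (_∘_)
open import Relation.Binary.PropositionalEquality
  using (_≢_; refl; sym; cong; cong₂; subst; module ≡-Reasoning) renaming (trans to ≡-trans)
open import Relation.Nullary using (¬_; yes; no; does)

open ≡-Reasoning

σ-fuel-zero : ∀ f → σ-fuel f 0 ≡ 0
σ-fuel-zero zero    = refl
σ-fuel-zero (suc f) = σ-fuel-zero f

n≤1+f⇒n/2≤f : ∀ {n f} → n ≤ suc f → n / 2 ≤ f
n≤1+f⇒n/2≤f {zero}  _     = z≤n
n≤1+f⇒n/2≤f {suc n} n≤1+f = ≤-pred (≤-trans (m/n<m (suc n) 2 (s≤s (s≤s z≤n))) n≤1+f)

σ-fuel-irrelevant : ∀ f f′ n → n ≤ f → n ≤ f′ → σ-fuel f n ≡ σ-fuel f′ n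
σ-fuel-irrelevant zero    zero     _ _   _   = refl
σ-fuel-irrelevant zero    (suc f′) _ z≤n _   = sym (σ-fuel-zero f′)
σ-fuel-irrelevant (suc f) zero     _ _   z≤n = σ-fuel-zero f
σ-fuel-irrelevant (suc f) (suc f′) n n≤f n≤f′ =
  cong (_+_ (n % 2)) (σ-fuel-irrelevant f f′ (n / 2) (n≤1+f⇒n/2≤f n≤f) (n≤1+f⇒n/2≤f n≤f′))

σ-unfold : ∀ n → σ n ≡ n % 2 + σ (n / 2)
σ-unfold zero    = refl
σ-unfold (suc n) =
  cong (_+_ (suc n % 2)) (σ-fuel-irrelevant n (suc n / 2) _ (n≤1+f⇒n/2≤f ≤-refl) ≤-refl)

σ[2^m+n]≡1+σ[n] : ∀ m {n} → n < 2 ^ m → σ (2 ^ m + n) ≡ suc (σ n)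
σ[2^m+n]≡1+σ[n] zero    {zero}  _           = refl
σ[2^m+n]≡1+σ[n] zero    {suc n} (s≤s ())
σ[2^m+n]≡1+σ[n] (suc m) {n} n<2^[1+m] = begin
  σ (2 ^ suc m + n)                             ≡⟨ σ-unfold (2 ^ suc m + n) ⟩
  (2 ^ suc m + n) % 2 + σ ((2 ^ suc m + n) / 2) ≡⟨ cong₂ (λ b x → b + σ x) last-bit higher-bits ⟩
  n % 2 + σ (2 ^ m + n / 2)                     ≡⟨ cong (_+_ (n % 2)) (σ[2^m+n]≡1+σ[n] m n/2<2^m) ⟩
  n % 2 + suc (σ (n / 2))                       ≡⟨ +-suc (n % 2) _ ⟩
  suc (n % 2 + σ (n / 2))                       ≡⟨ cong suc (σ-unfold n) ⟨
  suc (σ n)                                     ∎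
  where
  swapped : 2 ^ suc m + n ≡ n + 2 ^ m * 2
  swapped = ≡-trans (+-comm (2 ^ suc m) n) (cong (_+_ n) (*-comm 2 (2 ^ m)))
  last-bit : (2 ^ suc m + n) % 2 ≡ n % 2
  last-bit = ≡-trans (cong (_% 2) swapped) ([m+kn]%n≡m%n n (2 ^ m) 2)
  higher-bits : (2 ^ suc m + n) / 2 ≡ 2 ^ m + n / 2
  higher-bits = begin
    (2 ^ suc m + n) / 2       ≡⟨ cong (_/ 2) swapped ⟩
    (n + 2 ^ m * 2) / 2       ≡⟨ +-distrib-/-∣ʳ n (divides (2 ^ m) refl) ⟩
    n / 2 + 2 ^ m * 2 / 2     ≡⟨ cong (_+_ (n / 2)) (m*n/n≡m (2 ^ m) 2) ⟩
    n / 2 + 2 ^ m             ≡⟨ +-comm (n / 2) (2 ^ m) ⟩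
    2 ^ m + n / 2             ∎
  n/2<2^m : n / 2 < 2 ^ m
  n/2<2^m = m<n*o⇒m/o<n (subst (n <_) (*-comm 2 (2 ^ m)) n<2^[1+m])

∑ : (ℕ → ℤ) → ℕ → ℤ
∑ f zero    = + 0
∑ f (suc n) = ∑ f n +ᶻ f n

∑-cong : ∀ {f g} n → (∀ {i} → i < n → f i ≡ g i) → ∑ f n ≡ ∑ g n
∑-cong zero    _   = refl
∑-cong (suc n) f≗g = cong₂ _+ᶻ_ (∑-cong n (f≗g ∘ m<n⇒m<1+n)) (f≗g ≤-refl)

∑-+ : ∀ f m n → ∑ f (m + n) ≡ ∑ f m +ᶻ ∑ (λ i → f (m + i)) n
∑-+ f m zero    = ≡-trans (cong (∑ f) (+-identityʳ m)) (sym (ℤ.+-identityʳ (∑ f m)))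
∑-+ f m (suc n) = begin
  ∑ f (m + suc n)                                 ≡⟨ cong (∑ f) (+-suc m n) ⟩
  ∑ f (m + n) +ᶻ f (m + n)                        ≡⟨ cong (_+ᶻ f (m + n)) (∑-+ f m n) ⟩
  ∑ f m +ᶻ ∑ (λ i → f (m + i)) n +ᶻ f (m + n)     ≡⟨ ℤ.+-assoc (∑ f m) _ _ ⟩
  ∑ f m +ᶻ ∑ (λ i → f (m + i)) (suc n)            ∎

∑-suc : ∀ f n → ∑ f (suc n) ≡ f 0 +ᶻ ∑ (f ∘ suc) n
∑-suc f n = ≡-trans (∑-+ f 1 n) (cong (_+ᶻ ∑ (f ∘ suc) n) (ℤ.+-identityˡ (f 0)))

∑-neg : ∀ f n → ∑ (λ i → - f i) n ≡ - ∑ f n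
∑-neg f zero    = refl
∑-neg f (suc n) = ≡-trans (cong (_+ᶻ - f n) (∑-neg f n)) (sym (ℤ.neg-distrib-+ (∑ f n) (f n)))

∑-sub : ∀ f g n → ∑ (λ i → f i -ᶻ g i) n ≡ ∑ f n -ᶻ ∑ g n
∑-sub f g zero    = refl
∑-sub f g (suc n) =
  ≡-trans (cong (_+ᶻ (f n -ᶻ g n)) (∑-sub f g n)) (interchange (∑ f n) (∑ g n) (f n) (g n))
  where
  interchange : ∀ a b c d → (a -ᶻ b) +ᶻ (c -ᶻ d) ≡ (a +ᶻ c) -ᶻ (b +ᶻ d)
  interchange = solve-∀

∑-const : ∀ c n → ∑ (λ _ → c) n ≡ + n *ᶻ c
∑-const c zero    = sym (ℤ.*-zeroˡ c)
∑-const c (suc n) = begin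
  ∑ (λ _ → c) n +ᶻ c  ≡⟨ cong (_+ᶻ c) (∑-const c n) ⟩
  + n *ᶻ c +ᶻ c       ≡⟨ ℤ.+-comm (+ n *ᶻ c) c ⟩
  c +ᶻ + n *ᶻ c       ≡⟨ ℤ.suc-* (+ n) c ⟨
  + suc n *ᶻ c        ∎

module _ {A : Set} (f : ℕ → A) where

  periodic⇒multiple-periodic : ∀ {a} → (∀ r → f (r + a) ≡ f r) → ∀ j r → f (r + j * a) ≡ f r
  periodic⇒multiple-periodic     _   zero    r = cong f (+-identityʳ r)
  periodic⇒multiple-periodic {a} per (suc j) r = begin
    f (r + (a + j * a)) ≡⟨ cong f (+-assoc r a (j * a)) ⟨
    f (r + a + j * a)   ≡⟨ periodic⇒multiple-periodic per j (r + a) ⟩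
    f (r + a)           ≡⟨ per r ⟩
    f r                 ∎

  private
    bézout-step : ∀ {a b x y} → (∀ r → f (r + a) ≡ f r) → (∀ r → f (r + b) ≡ f r) →
                  1 + y * b ≡ x * a → ∀ r → f (suc r) ≡ f r
    bézout-step {a} {b} {x} {y} per-a per-b eq r = begin
      f (suc r)          ≡⟨ periodic⇒multiple-periodic per-b y (suc r) ⟨
      f (suc r + y * b)  ≡⟨ cong f (≡-trans (sym (+-suc r (y * b))) (cong (_+_ r) eq)) ⟩
      f (r + x * a)      ≡⟨ periodic⇒multiple-periodic per-a x r ⟩
      f r                ∎

  coprime-periods⇒constant : ∀ {a b} → Coprime a b →
    (∀ r → f (r + a) ≡ f r) → (∀ r → f (r + b) ≡ f r) → ∀ r → f r ≡ f 0
  coprime-periods⇒constant c per-a per-b zero    = refl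
  coprime-periods⇒constant c per-a per-b (suc r) =
    ≡-trans (one-periodic r) (coprime-periods⇒constant c per-a per-b r)
    where
    one-periodic : ∀ r → f (suc r) ≡ f r
    one-periodic with coprime-Bézout c
    ... | Bézout.+- x y eq = bézout-step {x = x} {y} per-a per-b eq
    ... | Bézout.-+ x y eq = bézout-step {x = y} {x} per-b per-a eq

unique∧⊆∧length≤⇒↭ : {A : Set} {xs ys : List A} →
  Unique xs → xs ⊆ ys → length ys ≤ length xs → xs ↭ ys
unique∧⊆∧length≤⇒↭ {xs = []}     {[]}    _ _ _ = refl
unique∧⊆∧length≤⇒↭ {xs = x ∷ xs} {ys} (x∉xs ∷ unique-xs) xs⊆ys |ys|≤|xs|
  with as , bs , refl ← ∈-∃++ (xs⊆ys (here refl)) =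
  trans (prep x (unique∧⊆∧length≤⇒↭ unique-xs xs⊆as++bs |as++bs|≤|xs|)) (↭-sym (shift x as bs))
  where
  xs⊆as++bs : xs ⊆ as ++ bs
  xs⊆as++bs z∈xs with ∈-resp-↭ (shift x as bs) (xs⊆ys (there z∈xs))
  ... | here refl = ⊥-elim (All.lookup x∉xs z∈xs refl)
  ... | there z∈as++bs = z∈as++bs
  |as++bs|≤|xs| : length (as ++ bs) ≤ length xs
  |as++bs|≤|xs| = ≤-pred (subst (_≤ suc (length xs)) (length-++-sucʳ as x bs) |ys|≤|xs|)

module _ {p : ℕ} .{{_ : NonZero p}} where

  +-%-congʳ : ∀ {a b} c → a % p ≡ b % p → (a + c) % p ≡ (b + c) % p
  +-%-congʳ {a} {b} c a≡b = begin
    (a + c) % p             ≡⟨ %-distribˡ-+ a c p ⟩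
    (a % p + c % p) % p     ≡⟨ cong (λ t → (t + c % p) % p) a≡b ⟩
    (b % p + c % p) % p     ≡⟨ %-distribˡ-+ b c p ⟨
    (b + c) % p             ∎

  +-%-absorbʳ : ∀ a b → (a + b) % p ≡ (a + b % p) % p
  +-%-absorbʳ a b = begin
    (a + b) % p             ≡⟨ %-distribˡ-+ a b p ⟩
    (a % p + b % p) % p     ≡⟨ cong (λ t → (a % p + t) % p) (m%n%n≡m%n b p) ⟨
    (a % p + b % p % p) % p ≡⟨ %-distribˡ-+ a (b % p) p ⟨
    (a + b % p) % p         ∎

  %≡%⇒∣∸ : ∀ {a b} → a % p ≡ b % p → p ∣ b ∸ a
  %≡%⇒∣∸ {a} {b} a≡b = divides (b / p ∸ a / p) (begin
    b ∸ a
      ≡⟨ cong₂ _∸_ (m≡m%n+[m/n]*n b p) (m≡m%n+[m/n]*n a p) ⟩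
    (b % p + b / p * p) ∸ (a % p + a / p * p)
      ≡⟨ cong (λ t → (b % p + b / p * p) ∸ (t + a / p * p)) a≡b ⟩
    (b % p + b / p * p) ∸ (b % p + a / p * p)
      ≡⟨ [m+n]∸[m+o]≡n∸o (b % p) _ _ ⟩
    b / p * p ∸ a / p * p
      ≡⟨ *-distribʳ-∸ p (b / p) (a / p) ⟨
    (b / p ∸ a / p) * p
      ∎)

  ∣∸⇒%≡% : ∀ {a b} → a ≤ b → p ∣ b ∸ a → a % p ≡ b % p
  ∣∸⇒%≡% {a} {b} a≤b (divides k b∸a≡kp) = begin
    a % p             ≡⟨ [m+kn]%n≡m%n a k p ⟨
    (a + k * p) % p   ≡⟨ cong (λ t → (a + t) % p) b∸a≡kp ⟨
    (a + (b ∸ a)) % p ≡⟨ cong (_% p) (m+[n∸m]≡n a≤b) ⟩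
    b % p             ∎

  ∣?-%-cong : ∀ {a b} → a % p ≡ b % p → does (p ∣? a) ≡ does (p ∣? b)
  ∣?-%-cong {a} {b} a≡b with p ∣? a | p ∣? b
  ... | yes _   | yes _   = refl
  ... | no  _   | no  _   = refl
  ... | yes p∣a | no  p∤b = ⊥-elim (p∤b (m%n≡0⇒n∣m b p (≡-trans (sym a≡b) (n∣m⇒m%n≡0 a p p∣a))))
  ... | no  p∤a | yes p∣b = ⊥-elim (p∤a (m%n≡0⇒n∣m a p (≡-trans a≡b (n∣m⇒m%n≡0 b p p∣b))))

module SignedResidueSums (p : ℕ) .{{_ : NonZero p}} where

  δ : ℕ → ℤ
  δ r = if does (p ∣? r) then + 1 else + 0

  δ-%-cong : ∀ {a b} → a % p ≡ b % p → δ a ≡ δ b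
  δ-%-cong a≡b = cong (λ d → if d then + 1 else + 0) (∣?-%-cong a≡b)

  δ-∣ : ∀ {r} → p ∣ r → δ r ≡ + 1
  δ-∣ {r} p∣r with p ∣? r
  ... | yes _   = refl
  ... | no  p∤r = ⊥-elim (p∤r p∣r)

  δ-∤ : ∀ {r} → ¬ p ∣ r → δ r ≡ + 0
  δ-∤ {r} p∤r with p ∣? r
  ... | yes p∣r = ⊥-elim (p∤r p∣r)
  ... | no  _   = refl

  summand : ℕ → ℕ → ℤ
  summand r n = if does (p ∣? (r + n)) then negOnePow (σ n) else + 0

  S′ : ℕ → ℕ → ℤ
  S′ r = ∑ (summand r)

  S≡S′ : ∀ x → S p x ≡ S′ 0 x
  S≡S′ zero    = refl
  S≡S′ (suc x) = cong (_+ᶻ summand 0 x) (S≡S′ x)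

  summand-2^m+n : ∀ m r {n} → n < 2 ^ m → summand r (2 ^ m + n) ≡ - summand (r + 2 ^ m) n
  summand-2^m+n m r {n} n<2^m
    rewrite σ[2^m+n]≡1+σ[n] m n<2^m | sym (+-assoc r (2 ^ m) n) with p ∣? (r + 2 ^ m + n)
  ... | yes _ = refl
  ... | no  _ = refl

  S′-double : ∀ m r → S′ r (2 ^ suc m) ≡ S′ r (2 ^ m) -ᶻ S′ (r + 2 ^ m) (2 ^ m)
  S′-double m r = begin
    S′ r (2 ^ suc m)
      ≡⟨ cong (S′ r ∘ (_+_ (2 ^ m))) (+-identityʳ (2 ^ m)) ⟩
    S′ r (2 ^ m + 2 ^ m)
      ≡⟨ ∑-+ (summand r) (2 ^ m) (2 ^ m) ⟩
    S′ r (2 ^ m) +ᶻ ∑ (summand r ∘ (_+_ (2 ^ m))) (2 ^ m)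
      ≡⟨ cong (S′ r (2 ^ m) +ᶻ_) upper-half ⟩
    S′ r (2 ^ m) -ᶻ S′ (r + 2 ^ m) (2 ^ m)
      ∎
    where
    upper-half : ∑ (summand r ∘ (_+_ (2 ^ m))) (2 ^ m) ≡ - S′ (r + 2 ^ m) (2 ^ m)
    upper-half = ≡-trans (∑-cong (2 ^ m) (summand-2^m+n m r)) (∑-neg (summand (r + 2 ^ m)) (2 ^ m))

  Δ : List ℕ → ℕ → ℤ
  Δ []      r = δ r
  Δ (e ∷ L) r = Δ L r -ᶻ Δ L (r + e)

  S′-2^m≡Δ : ∀ m r → S′ r (2 ^ m) ≡ Δ (applyDownFrom (2 ^_) m) r
  S′-2^m≡Δ zero    r = ≡-trans (ℤ.+-identityˡ _) (cong δ (+-identityʳ r))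
  S′-2^m≡Δ (suc m) r =
    ≡-trans (S′-double m r) (cong₂ _-ᶻ_ (S′-2^m≡Δ m r) (S′-2^m≡Δ m (r + 2 ^ m)))

  -- Δₖ k L r is the part of Δ L r coming from the sub-multisets T ⊆ L with |T| = k.
  Δₖ : ℕ → List ℕ → ℕ → ℤ
  Δₖ zero    _       r = δ r
  Δₖ (suc k) []      r = + 0
  Δₖ (suc k) (e ∷ L) r = Δₖ (suc k) L r -ᶻ Δₖ k L (r + e)

  Δₖ-%-cong : ∀ k L {a b} → a % p ≡ b % p → Δₖ k L a ≡ Δₖ k L b
  Δₖ-%-cong zero    _       a≡b = δ-%-cong a≡b
  Δₖ-%-cong (suc k) []      a≡b = refl
  Δₖ-%-cong (suc k) (e ∷ L) a≡b =
    cong₂ _-ᶻ_ (Δₖ-%-cong (suc k) L a≡b) (Δₖ-%-cong k L (+-%-congʳ e a≡b))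

  Δₖ-mod : ∀ k L r → Δₖ k (map (_% p) L) r ≡ Δₖ k L r
  Δₖ-mod zero    _       r = refl
  Δₖ-mod (suc k) []      r = refl
  Δₖ-mod (suc k) (e ∷ L) r = cong₂ _-ᶻ_ (Δₖ-mod (suc k) L r)
    (≡-trans (Δₖ-mod k L (r + e % p)) (Δₖ-%-cong k L (sym (+-%-absorbʳ r e))))

  Δₖ-swap : ∀ k x y L r → Δₖ k (x ∷ y ∷ L) r ≡ Δₖ k (y ∷ x ∷ L) r
  Δₖ-swap zero          x y L r = refl
  Δₖ-swap (suc zero)    x y L r = exchange (Δₖ 1 L r) (δ (r + y)) (δ (r + x))
    where
    exchange : ∀ a b c → a -ᶻ b -ᶻ c ≡ a -ᶻ c -ᶻ b
    exchange = solve-∀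
  Δₖ-swap (suc (suc k)) x y L r = begin
    Δₖ (2 + k) L r -ᶻ Δₖ (suc k) L (r + y) -ᶻ (Δₖ (suc k) L (r + x) -ᶻ Δₖ k L (r + x + y))
      ≡⟨ cong (λ t → Δₖ (2 + k) L r -ᶻ Δₖ (suc k) L (r + y) -ᶻ (Δₖ (suc k) L (r + x) -ᶻ Δₖ k L t))
              (+-comm-after r x y) ⟩
    Δₖ (2 + k) L r -ᶻ Δₖ (suc k) L (r + y) -ᶻ (Δₖ (suc k) L (r + x) -ᶻ Δₖ k L (r + y + x))
      ≡⟨ exchange (Δₖ (2 + k) L r) _ _ _ ⟩
    Δₖ (2 + k) L r -ᶻ Δₖ (suc k) L (r + x) -ᶻ (Δₖ (suc k) L (r + y) -ᶻ Δₖ k L (r + y + x))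
      ∎
    where
    exchange : ∀ a b c d → a -ᶻ b -ᶻ (c -ᶻ d) ≡ a -ᶻ c -ᶻ (b -ᶻ d)
    exchange = solve-∀
    +-comm-after : ∀ r x y → r + x + y ≡ r + y + x
    +-comm-after = ℕ-Solver.solve-∀

  Δₖ-resp-↭ : ∀ k {L L′} → L ↭ L′ → ∀ r → Δₖ k L r ≡ Δₖ k L′ r
  Δₖ-resp-↭ zero          _                 r = refl
  Δₖ-resp-↭ k             refl              r = refl
  Δₖ-resp-↭ (suc k)       (prep e P)        r =
    cong₂ _-ᶻ_ (Δₖ-resp-↭ (suc k) P r) (Δₖ-resp-↭ k P (r + e))
  Δₖ-resp-↭ (suc zero)    (swap {xs} x y P) r = ≡-trans (Δₖ-swap 1 x y xs r)
    (cong (λ t → t -ᶻ δ (r + x) -ᶻ δ (r + y)) (Δₖ-resp-↭ 1 P r))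
  Δₖ-resp-↭ (suc (suc k)) (swap {xs} x y P) r = ≡-trans (Δₖ-swap (2 + k) x y xs r)
    (cong₂ _-ᶻ_ (cong₂ _-ᶻ_ (Δₖ-resp-↭ (2 + k) P r) (Δₖ-resp-↭ (suc k) P (r + x)))
                (cong₂ _-ᶻ_ (Δₖ-resp-↭ (suc k) P (r + y)) (Δₖ-resp-↭ k P (r + y + x))))
  Δₖ-resp-↭ k             (trans P Q)       r = ≡-trans (Δₖ-resp-↭ k P r) (Δₖ-resp-↭ k Q r)

  Δₖ-map-suc : ∀ k L r → Δₖ k (map suc L) r ≡ Δₖ k L (r + k)
  Δₖ-map-suc zero    _       r = cong δ (sym (+-identityʳ r))
  Δₖ-map-suc (suc k) []      r = refl
  Δₖ-map-suc (suc k) (e ∷ L) r = cong₂ _-ᶻ_ (Δₖ-map-suc (suc k) L r)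
    (≡-trans (Δₖ-map-suc k L (r + suc e)) (cong (Δₖ k L) (rearrange r e k)))
    where
    rearrange : ∀ r e k → r + suc e + k ≡ r + suc k + e
    rearrange = ℕ-Solver.solve-∀

  Δ≡∑Δₖ : ∀ L {n} r → length L < n → Δ L r ≡ ∑ (λ k → Δₖ k L r) n
  Δ≡∑Δₖ []      {suc n} r _ = sym (begin
    ∑ (λ k → Δₖ k [] r) (suc n) ≡⟨ ∑-suc (λ k → Δₖ k [] r) n ⟩
    δ r +ᶻ ∑ (λ _ → + 0) n      ≡⟨ cong (δ r +ᶻ_) (≡-trans (∑-const (+ 0) n) (ℤ.*-zeroʳ (+ n))) ⟩
    δ r +ᶻ + 0                  ≡⟨ ℤ.+-identityʳ (δ r) ⟩
    δ r                         ∎)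
  Δ≡∑Δₖ (e ∷ L) {suc n} r (s≤s |L|<n) = sym (begin
    ∑ (λ k → Δₖ k (e ∷ L) r) (suc n)
      ≡⟨ ∑-suc (λ k → Δₖ k (e ∷ L) r) n ⟩
    δ r +ᶻ ∑ (λ k → Δₖ (suc k) L r -ᶻ Δₖ k L (r + e)) n
      ≡⟨ cong (δ r +ᶻ_) (∑-sub (λ k → Δₖ (suc k) L r) (λ k → Δₖ k L (r + e)) n) ⟩
    δ r +ᶻ (∑ (λ k → Δₖ (suc k) L r) n -ᶻ ∑ (λ k → Δₖ k L (r + e)) n)
      ≡⟨ ℤ.+-assoc (δ r) _ _ ⟨
    δ r +ᶻ ∑ (λ k → Δₖ (suc k) L r) n -ᶻ ∑ (λ k → Δₖ k L (r + e)) n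
      ≡⟨ cong (_-ᶻ ∑ (λ k → Δₖ k L (r + e)) n) (∑-suc (λ k → Δₖ k L r) n) ⟨
    ∑ (λ k → Δₖ k L r) (suc n) -ᶻ ∑ (λ k → Δₖ k L (r + e)) n
      ≡⟨ cong₂ _-ᶻ_ (Δ≡∑Δₖ L r (m<n⇒m<1+n |L|<n)) (Δ≡∑Δₖ L (r + e) |L|<n) ⟨
    Δ L r -ᶻ Δ L (r + e)
      ∎)

  Δₖ-agree⇒Δ-agree : ∀ {L L′} → length L ≡ length L′ →
                     (∀ k r → Δₖ k L r ≡ Δₖ k L′ r) → ∀ r → Δ L r ≡ Δ L′ r
  Δₖ-agree⇒Δ-agree {L} {L′} |L|≡|L′| Δₖ-agree r = begin
    Δ L r                                 ≡⟨ Δ≡∑Δₖ L r ≤-refl ⟩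
    ∑ (λ k → Δₖ k L r) (suc (length L))   ≡⟨ ∑-cong (suc (length L)) (λ {k} _ → Δₖ-agree k r) ⟩
    ∑ (λ k → Δₖ k L′ r) (suc (length L))  ≡⟨ Δ≡∑Δₖ L′ r (s≤s (≤-reflexive (sym |L|≡|L′|))) ⟨
    Δ L′ r                                ∎

  Δ-mod : ∀ L r → Δ (map (_% p) L) r ≡ Δ L r
  Δ-mod L = Δₖ-agree⇒Δ-agree (length-map (_% p) L) (λ k → Δₖ-mod k L)

  Δ-resp-↭ : ∀ {L L′} → L ↭ L′ → ∀ r → Δ L r ≡ Δ L′ r
  Δ-resp-↭ P = Δₖ-agree⇒Δ-agree (↭-length P) (λ k → Δₖ-resp-↭ k P)

module PrimeModulus (q : ℕ) (prime : Prime (suc q)) where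

  private
    p : ℕ
    p = suc q

  open SignedResidueSums p

  1<p : 1 < p
  1<p = nonTrivial⇒n>1 p {{prime⇒nonTrivial prime}}

  nonzeroResidues : List ℕ
  nonzeroResidues = applyUpTo suc q

  residues-rotate : map (_% p) (map suc (upTo p)) ↭ map (_% p) (upTo p)
  residues-rotate =
    subst (_↭ map (_% p) (upTo p)) (sym rotated) (↭-sym (∷↭∷ʳ 0 (map (_% p) nonzeroResidues)))
    where
    rotated : map (_% p) (map suc (upTo p)) ≡ map (_% p) nonzeroResidues ∷ʳ 0
    rotated = begin
      map (_% p) (map suc (upTo p))        ≡⟨ cong (map (_% p)) (map-applyUpTo (λ i → i) suc p) ⟩
      map (_% p) (applyUpTo suc p)         ≡⟨ cong (map (_% p)) (applyUpTo-∷ʳ suc q) ⟨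
      map (_% p) (nonzeroResidues ∷ʳ p)    ≡⟨ map-++ (_% p) nonzeroResidues (p ∷ []) ⟩
      map (_% p) nonzeroResidues ∷ʳ p % p  ≡⟨ cong (map (_% p) nonzeroResidues ∷ʳ_) (n%n≡0 p) ⟩
      map (_% p) nonzeroResidues ∷ʳ 0      ∎

  Δₖ-residues-periodic : ∀ k r → Δₖ k (upTo p) (r + k) ≡ Δₖ k (upTo p) r
  Δₖ-residues-periodic k r = begin
    Δₖ k (upTo p) (r + k)                   ≡⟨ Δₖ-map-suc k (upTo p) r ⟨
    Δₖ k (map suc (upTo p)) r               ≡⟨ Δₖ-mod k (map suc (upTo p)) r ⟨
    Δₖ k (map (_% p) (map suc (upTo p))) r  ≡⟨ Δₖ-resp-↭ k residues-rotate r ⟩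
    Δₖ k (map (_% p) (upTo p)) r            ≡⟨ Δₖ-mod k (upTo p) r ⟩
    Δₖ k (upTo p) r                         ∎

  Δₖ-residues-constant : ∀ {k} → suc k < p →
                         ∀ r → Δₖ (suc k) (upTo p) r ≡ Δₖ (suc k) (upTo p) 0
  Δₖ-residues-constant {k} 1+k<p = coprime-periods⇒constant (λ r → Δₖ (suc k) (upTo p) r)
    (prime⇒coprime prime 1+k<p)
    (λ r → Δₖ-%-cong (suc k) (upTo p) ([m+n]%n≡m%n r p))
    (Δₖ-residues-periodic (suc k))

  Δₖ-nonzeroResidues : ∀ {k} → k < p →
                       ∀ r → Δₖ k nonzeroResidues r -ᶻ Δₖ k nonzeroResidues 0 ≡ δ r -ᶻ δ 0
  Δₖ-nonzeroResidues {zero}  _     r = refl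
  Δₖ-nonzeroResidues {suc k} 1+k<p r = begin
    Δₖ (suc k) M r -ᶻ Δₖ (suc k) M 0
      ≡⟨ cong₂ _-ᶻ_ (split r) (split 0) ⟩
    (Δₖ (suc k) (upTo p) r +ᶻ Δₖ k M r) -ᶻ (Δₖ (suc k) (upTo p) 0 +ᶻ Δₖ k M 0)
      ≡⟨ cong (λ c → (c +ᶻ Δₖ k M r) -ᶻ (Δₖ (suc k) (upTo p) 0 +ᶻ Δₖ k M 0))
              (Δₖ-residues-constant 1+k<p r) ⟩
    (Δₖ (suc k) (upTo p) 0 +ᶻ Δₖ k M r) -ᶻ (Δₖ (suc k) (upTo p) 0 +ᶻ Δₖ k M 0)
      ≡⟨ cancel (Δₖ (suc k) (upTo p) 0) (Δₖ k M r) (Δₖ k M 0) ⟩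
    Δₖ k M r -ᶻ Δₖ k M 0
      ≡⟨ Δₖ-nonzeroResidues (<⇒≤ 1+k<p) r ⟩
    δ r -ᶻ δ 0
      ∎
    where
    M = nonzeroResidues
    cancel : ∀ c a b → (c +ᶻ a) -ᶻ (c +ᶻ b) ≡ a -ᶻ b
    cancel = solve-∀
    add-back : ∀ a b → a ≡ (a -ᶻ b) +ᶻ b
    add-back = solve-∀
    split : ∀ r → Δₖ (suc k) M r ≡ Δₖ (suc k) (upTo p) r +ᶻ Δₖ k M r
    split r = ≡-trans (add-back (Δₖ (suc k) M r) (Δₖ k M (r + 0)))
                      (cong (λ t → Δₖ (suc k) (upTo p) r +ᶻ Δₖ k M t) (+-identityʳ r))

  Δ-1∷nonzeroResidues : Δ (1 ∷ nonzeroResidues) 0 ≡ + p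
  Δ-1∷nonzeroResidues = begin
    Δ M 0 -ᶻ Δ M 1
      ≡⟨ flip (Δ M 0) (Δ M 1) ⟩
    - (Δ M 1 -ᶻ Δ M 0)
      ≡⟨ cong -_ (cong₂ _-ᶻ_ (Δ≡∑Δₖ M 1 |M|<p) (Δ≡∑Δₖ M 0 |M|<p)) ⟩
    - (∑ (λ k → Δₖ k M 1) p -ᶻ ∑ (λ k → Δₖ k M 0) p)
      ≡⟨ cong -_ (∑-sub (λ k → Δₖ k M 1) (λ k → Δₖ k M 0) p) ⟨
    - ∑ (λ k → Δₖ k M 1 -ᶻ Δₖ k M 0) p
      ≡⟨ cong -_ (∑-cong p (λ k<p → Δₖ-nonzeroResidues k<p 1)) ⟩
    - ∑ (λ _ → δ 1 -ᶻ δ 0) p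
      ≡⟨ cong (λ c → - ∑ (λ _ → c) p) δ1-δ0≡-1 ⟩
    - ∑ (λ _ → -1ℤ) p
      ≡⟨ cong -_ (≡-trans (∑-const -1ℤ p) (≡-trans (ℤ.*-comm (+ p) -1ℤ) (ℤ.-1*i≡-i (+ p)))) ⟩
    - - + p
      ≡⟨ ℤ.neg-involutive (+ p) ⟩
    + p
      ∎
    where
    M = nonzeroResidues
    flip : ∀ a b → a -ᶻ b ≡ - (b -ᶻ a)
    flip = solve-∀
    |M|<p : length M < p
    |M|<p = s≤s (≤-reflexive (length-applyUpTo suc q))
    δ1-δ0≡-1 : δ 1 -ᶻ δ 0 ≡ -1ℤ
    δ1-δ0≡-1 = cong₂ _-ᶻ_ (δ-∤ (λ p∣1 → <⇒≱ 1<p (∣⇒≤ p∣1))) (δ-∣ (p ∣0))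

  module _ (root : PrimitiveRoot2 p) where

    2^q%p≡1 : 2 ^ q % p ≡ 1
    2^q%p≡1 = ≡-trans (proj₁ root) (m<n⇒m%n≡m 1<p)

    p∤2^i : ∀ {i} → i ≤ q → ¬ p ∣ 2 ^ i
    p∤2^i {i} i≤q p∣2^i = 0≢1+n (≡-trans (sym (n∣m⇒m%n≡0 (2 ^ q) p p∣2^q)) 2^q%p≡1)
      where
      p∣2^q : p ∣ 2 ^ q
      p∣2^q = subst (p ∣_)
        (≡-trans (sym (^-distribˡ-+-* 2 i (q ∸ i))) (cong (2 ^_) (m+[n∸m]≡n i≤q)))
        (∣-trans p∣2^i (m∣m*n (2 ^ (q ∸ i))))

    2^[j+d]≡2^j⇒2^d≡1 : ∀ j d → j ≤ q → 2 ^ (j + d) % p ≡ 2 ^ j % p → 2 ^ d % p ≡ 1 % p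
    2^[j+d]≡2^j⇒2^d≡1 j d j≤q 2^[j+d]≡2^j =
      [ (λ p∣2^j → ⊥-elim (p∤2^i j≤q p∣2^j)) , sym ∘ ∣∸⇒%≡% (m^n>0 2 d) ]′
        (euclidsLemma (2 ^ j) (2 ^ d ∸ 1) prime p∣2^j[2^d∸1])
      where
      p∣2^j[2^d∸1] : p ∣ 2 ^ j * (2 ^ d ∸ 1)
      p∣2^j[2^d∸1] = subst (p ∣_) (begin
        2 ^ (j + d) ∸ 2 ^ j       ≡⟨ cong₂ _∸_ (^-distribˡ-+-* 2 j d) (sym (*-identityʳ (2 ^ j))) ⟩
        2 ^ j * 2 ^ d ∸ 2 ^ j * 1 ≡⟨ *-distribˡ-∸ (2 ^ j) (2 ^ d) 1 ⟨
        2 ^ j * (2 ^ d ∸ 1)       ∎)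
        (%≡%⇒∣∸ {a = 2 ^ j} {b = 2 ^ (j + d)} (sym 2^[j+d]≡2^j))

    2^i%p-injective : ∀ {i j} → j < i → i < q → 2 ^ i % p ≢ 2 ^ j % p
    2^i%p-injective {i} {j} j<i i<q 2^i≡2^j =
      proj₂ root (i ∸ j) (m<n⇒0<n∸m j<i) (≤-<-trans (m∸n≤m i j) i<q)
        (2^[j+d]≡2^j⇒2^d≡1 j (i ∸ j) (<⇒≤ (<-trans j<i i<q))
          (subst (λ t → 2 ^ t % p ≡ 2 ^ j % p) (sym (m+[n∸m]≡n (<⇒≤ j<i))) 2^i≡2^j))

    powers%p↭nonzeroResidues : applyDownFrom (λ i → 2 ^ i % p) q ↭ nonzeroResidues
    powers%p↭nonzeroResidues = unique∧⊆∧length≤⇒↭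
      (applyDownFrom⁺₁ _ q 2^i%p-injective)
      powers%p⊆nonzeroResidues
      (≤-reflexive (≡-trans (length-applyUpTo suc q) (sym (length-applyDownFrom _ q))))
      where
      nonzero-residue : ∀ {z} → 0 < z → z < p → z ∈ nonzeroResidues
      nonzero-residue {suc z} _ (s≤s z<q) = ∈-applyUpTo⁺ suc z<q
      powers%p⊆nonzeroResidues : applyDownFrom (λ i → 2 ^ i % p) q ⊆ nonzeroResidues
      powers%p⊆nonzeroResidues z∈ with i , i<q , refl ← ∈-applyDownFrom⁻ (λ i → 2 ^ i % p) z∈ =
        nonzero-residue (n≢0⇒n>0 (p∤2^i (<⇒≤ i<q) ∘ m%n≡0⇒n∣m (2 ^ i) p)) (m%n<n (2 ^ i) p)

    Δ-powers : Δ (applyDownFrom (2 ^_) p) 0 ≡ Δ (1 ∷ nonzeroResidues) 0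
    Δ-powers = begin
      Δ (applyDownFrom (2 ^_) p) 0
        ≡⟨ Δ-mod (applyDownFrom (2 ^_) p) 0 ⟨
      Δ (2 ^ q % p ∷ map (_% p) (applyDownFrom (2 ^_) q)) 0
        ≡⟨ cong₂ (λ e L → Δ (e ∷ L) 0) 2^q%p≡1 (map-applyDownFrom (2 ^_) (_% p) q) ⟩
      Δ (1 ∷ applyDownFrom (λ i → 2 ^ i % p) q) 0
        ≡⟨ Δ-resp-↭ (prep 1 powers%p↭nonzeroResidues) 0 ⟩
      Δ (1 ∷ nonzeroResidues) 0
        ∎

theorem1 : (p : ℕ) → (pr : Prime p) → PrimitiveRoot2 p {{prime⇒nonZero pr}} → S p (2 ^ p) ≡ + p
theorem1 zero    pr _    = ⊥-elim (¬prime[0] pr)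
theorem1 (suc q) pr root = begin
  S (suc q) (2 ^ suc q)                    ≡⟨ S≡S′ (2 ^ suc q) ⟩
  S′ 0 (2 ^ suc q)                         ≡⟨ S′-2^m≡Δ (suc q) 0 ⟩
  Δ (applyDownFrom (2 ^_) (suc q)) 0       ≡⟨ Δ-powers root ⟩
  Δ (1 ∷ nonzeroResidues) 0                ≡⟨ Δ-1∷nonzeroResidues ⟩
  + suc q                                  ∎
  where
  open SignedResidueSums (suc q)
  open PrimeModulus q pr
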